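{- Let $C_0$ be an element of the center of $\Delta$. Then for all $(A,\mathbf a)\in\tilde\Delta$, $\tilde T(C_0,\mathbf 0)\,\tilde T(A,\mathbf a)=\tilde T(C_0A,C_0\mathbf a)$ in $\tilde R$.
   Context: $G$ is a group, $\Delta$ a submonoid, $\Gamma$ a subgroup of $\Delta$ such that for every $A\in\Delta$ the sets $\Gamma\backslash\Gamma A\Gamma$ and $\Gamma A\Gamma/\Gamma$ are finite. $\mathcal M$ is a two-sided $\Delta$-module such that $\mathcal M/(A\mathcal M\cap\mathcal MA)$ is finite for all $A\in\Delta$, $\mathcal M$ is a sub-$\Delta$-module of a two-sided $G$-module $\mathcal M'$, and $A\mathcal M\supset\mathcal MA$ for every $A\in\Delta$. $\tilde\Delta=\Delta\times\mathcal M$ with product $(A,\mathbf a)(B,\mathbf b)=(AB,A\mathbf b+\mathbf aB)$, $\tilde\Gamma=\Gamma\times\mathcal M$. $\tilde R$ is the Hecke ring of $(\tilde\Gamma,\tilde\Delta)$: free abelian group on $\tilde\Gamma\backslash\tilde\Delta/\tilde\Gamma$ with $(\tilde\Gamma\alpha\tilde\Gamma)(\tilde\Gamma\beta\tilde\Gamma)=\sum m_\gamma\,\tilde\Gamma\gamma\tilde\Gamma$, $m_\gamma=\#\{\tilde\Gamma\delta\in\tilde\Gamma\backslash\tilde\Gamma\beta\tilde\Gamma:\gamma\delta^{ -1}\in\tilde\Gamma\alpha\tilde\Gamma\}$; $\tilde T(A,\mathbf a)=\tilde\Gamma(A,\mathbf a)\tilde\Gamma$. -}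

module Defs where

open import Algebra.Structures using (IsGroup; IsAbelianGroup)
open import Relation.Binary.PropositionalEquality using (_≡_)
open import Data.Product using (Σ; ∃; _×_; _,_; proj₁; proj₂)
open import Data.List using (List)
open import Data.List.Relation.Unary.Any using (Any)
open import Data.List.Relation.Unary.All using (All)
open import Relation.Nullary using (¬_)

record HeckeSetting : Set₁ where
  infixl 7 _·_
  infixl 6 _+_
  infixr 8 _▷_
  infixl 8 _◁_
  field
    G       : Set
    _·_     : G → G → G
    e       : G
    inv     : G → G
    isGroup : IsGroup _≡_ _·_ e inv
    Δ   : G → Set
    Δ-e : Δ e
    Δ-· : ∀ {x y} → Δ x → Δ y → Δ (x · y)
    Γ     : G → Set
    Γ⊆Δ   : ∀ {x} → Γ x → Δ x
    Γ-e   : Γ e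
    Γ-·   : ∀ {x y} → Γ x → Γ y → Γ (x · y)
    Γ-inv : ∀ {x} → Γ x → Γ (inv x)
    -- Γ\ΓAΓ finite: Γ A Γ is covered by finitely many right cosets Γ y
    Γ\ΓAΓ-finite : ∀ A → Δ A → Σ (List G) λ ys →
      ∀ g h → Γ g → Γ h → Any (λ y → Γ ((g · A · h) · inv y)) ys
    -- ΓAΓ/Γ finite: Γ A Γ is covered by finitely many left cosets y Γ
    ΓAΓ/Γ-finite : ∀ A → Δ A → Σ (List G) λ ys →
      ∀ g h → Γ g → Γ h → Any (λ y → Γ (inv y · (g · A · h))) ys
    M'    : Set
    _+_   : M' → M' → M'
    0m    : M'
    -_    : M' → M'
    isAbelianGroup : IsAbelianGroup _≡_ _+_ 0m -_
    _▷_   : G → M' → M'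
    _◁_   : M' → G → M'
    ▷-+   : ∀ g a b → g ▷ (a + b) ≡ g ▷ a + g ▷ b
    ▷-·   : ∀ g h a → (g · h) ▷ a ≡ g ▷ (h ▷ a)
    ▷-e   : ∀ a → e ▷ a ≡ a
    ◁-+   : ∀ a b g → (a + b) ◁ g ≡ a ◁ g + b ◁ g
    ◁-·   : ∀ a g h → a ◁ (g · h) ≡ (a ◁ g) ◁ h
    ◁-e   : ∀ a → a ◁ e ≡ a
    ▷◁    : ∀ g a h → (g ▷ a) ◁ h ≡ g ▷ (a ◁ h)
    M     : M' → Set
    M-0   : M 0m
    M-+   : ∀ {a b} → M a → M b → M (a + b)
    M-neg : ∀ {a} → M a → M (- a)
    M-▷   : ∀ {A a} → Δ A → M a → M (A ▷ a)
    M-◁   : ∀ {A a} → Δ A → M a → M (a ◁ A)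
    -- M/(AM ∩ MA) finite: finitely many coset representatives n ∈ M
    M/AM∩MA-finite : ∀ A → Δ A → Σ (List M') λ ns → All M ns ×
      (∀ m → M m → Any (λ n →
         (∃ λ b → M b × m + - n ≡ A ▷ b) × (∃ λ c → M c × m + - n ≡ c ◁ A)) ns)
    AM⊇MA : ∀ A → Δ A → ∀ m → M m → ∃ λ m' → M m' × m ◁ A ≡ A ▷ m'

module Tilde (S : HeckeSetting) where
  open HeckeSetting S

  G̃ : Set
  G̃ = G × M'

  _⊗_ : G̃ → G̃ → G̃
  (A , a) ⊗ (B , b) = (A · B , A ▷ b + a ◁ B)

  inv~ : G̃ → G̃
  inv~ (A , a) = (inv A , - ((inv A ▷ a) ◁ inv A))

  Δ̃ : G̃ → Set
  Δ̃ (A , a) = Δ A × M a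

  Γ̃ : G̃ → Set
  Γ̃ (A , a) = Γ A × M a

  _∈Γ̃_Γ̃ : G̃ → G̃ → Set
  γ ∈Γ̃ α Γ̃ = ∃ λ g → ∃ λ h → Γ̃ g × Γ̃ h × γ ≡ (g ⊗ α) ⊗ h

  -- Γ̃δ is one of the right cosets counted by m_γ in (Γ̃αΓ̃)(Γ̃βΓ̃):
  -- Γ̃δ ⊆ Γ̃βΓ̃ and γδ⁻¹ ∈ Γ̃αΓ̃
  Counted : (α β γ δ : G̃) → Set
  Counted α β γ δ = (δ ∈Γ̃ β Γ̃) × ((γ ⊗ inv~ δ) ∈Γ̃ α Γ̃)

  -- m_γ = 1 : exactly one right coset Γ̃δ is counted
  Coeff≡1 : (α β γ : G̃) → Set
  Coeff≡1 α β γ = (∃ λ δ → Counted α β γ δ) ×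
    (∀ δ δ' → Counted α β γ δ → Counted α β γ δ' → Γ̃ (δ' ⊗ inv~ δ))

  -- m_γ = 0 : no right coset is counted
  Coeff≡0 : (α β γ : G̃) → Set
  Coeff≡0 α β γ = ∀ δ → ¬ Counted α β γ δ

  -- (Γ̃αΓ̃)(Γ̃βΓ̃) = Γ̃ξΓ̃ in the Hecke ring R̃, i.e. comparing the
  -- coefficient of every double coset Γ̃γΓ̃ ⊆ Δ̃ on both sides.
  HeckeProdEq : (α β ξ : G̃) → Set
  HeckeProdEq α β ξ = ∀ γ → Δ̃ γ →
    (γ ∈Γ̃ ξ Γ̃ → Coeff≡1 α β γ) × (¬ (γ ∈Γ̃ ξ Γ̃) → Coeff≡0 α β γ)

-- The double coset Γ̃αΓ̃ of α = (C₀, 0) is the single right coset αΓ̃: conjugating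
-- (g, m) ∈ Γ̃ past α only moves m from MC₀ into C₀M, and C₀ commutes with g.
-- Hence a right coset Γ̃δ is counted in the coefficient of γ iff Γ̃δ = Γ̃α⁻¹γ and
-- α⁻¹γ ∈ Γ̃βΓ̃, so every coefficient is 1 or 0 according as γ lies in αΓ̃βΓ̃.
-- Finally αΓ̃βΓ̃ = Γ̃αβΓ̃: writing (k, m) = (k, 0)(1, k⁻¹m), the factor (k, 0)
-- commutes with α, and (1, m')β = β(1, p) because MA ⊆ AM.
module Submission where

open import Algebra.Bundles using (Group)
open import Algebra.Structures using (IsGroup; IsAbelianGroup)
import Algebra.Properties.Group as GroupProperties
open import Data.Product using (_×_; _,_; ∃)
open import Function using (_∘_)
open import Relation.Binary.PropositionalEquality
  using (_≡_; refl; sym; trans; cong; cong₂; subst; isEquivalence; module ≡-Reasoning)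
open import Relation.Nullary using (¬_)
open import Defs

module HeckeProduct (S : HeckeSetting) where
  open HeckeSetting S
  open Tilde S
  open ≡-Reasoning

  open IsGroup isGroup using ()
    renaming (identityˡ to ·-identityˡ; identityʳ to ·-identityʳ; inverseˡ to ·-inverseˡ;
              inverseʳ to ·-inverseʳ)
  open IsAbelianGroup isAbelianGroup using ()
    renaming (identityˡ to +-identityˡ; identityʳ to +-identityʳ; inverseˡ to +-inverseˡ;
              inverseʳ to +-inverseʳ; assoc to +-assoc; comm to +-comm)

  +-group : Group _ _
  +-group = record { isGroup = IsAbelianGroup.isGroup isAbelianGroup }

  open GroupProperties +-group using ()
    renaming (∙-cancelˡ to +-cancelˡ; inverseˡ-unique to +-inverseˡ-unique)

  module _ (f : M' → M') (f-+ : ∀ a b → f (a + b) ≡ f a + f b) where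

    additive-0m : f 0m ≡ 0m
    additive-0m = +-cancelˡ (f 0m) (f 0m) 0m (begin
      f 0m + f 0m  ≡⟨ f-+ 0m 0m ⟨
      f (0m + 0m)  ≡⟨ cong f (+-identityˡ 0m) ⟩
      f 0m         ≡⟨ +-identityʳ (f 0m) ⟨
      f 0m + 0m    ∎)

    additive-neg : ∀ a → f (- a) ≡ - f a
    additive-neg a = +-inverseˡ-unique (f (- a)) (f a) (begin
      f (- a) + f a  ≡⟨ f-+ (- a) a ⟨
      f (- a + a)    ≡⟨ cong f (+-inverseˡ a) ⟩
      f 0m           ≡⟨ additive-0m ⟩
      0m             ∎)

  ▷-0m : ∀ g → g ▷ 0m ≡ 0m
  ▷-0m g = additive-0m (g ▷_) (▷-+ g)

  0m-◁ : ∀ g → 0m ◁ g ≡ 0m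
  0m-◁ g = additive-0m (_◁ g) (λ a b → ◁-+ a b g)

  ▷-neg : ∀ g a → g ▷ (- a) ≡ - (g ▷ a)
  ▷-neg g = additive-neg (g ▷_) (▷-+ g)

  neg-◁ : ∀ a g → (- a) ◁ g ≡ - (a ◁ g)
  neg-◁ a g = additive-neg (_◁ g) (λ a b → ◁-+ a b g) a

  ẽ : G̃
  ẽ = e , 0m

  ⊗-assoc : ∀ x y z → ((x ⊗ y) ⊗ z) ≡ (x ⊗ (y ⊗ z))
  ⊗-assoc (A , a) (B , b) (C , c) = cong₂ _,_ (IsGroup.assoc isGroup A B C) (begin
    (A · B) ▷ c + (A ▷ b + a ◁ B) ◁ C          ≡⟨ cong₂ _+_ (▷-· A B c) (◁-+ (A ▷ b) (a ◁ B) C) ⟩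
    A ▷ (B ▷ c) + ((A ▷ b) ◁ C + (a ◁ B) ◁ C)  ≡⟨ cong (A ▷ (B ▷ c) +_) (cong₂ _+_ (▷◁ A b C) (sym (◁-· a B C))) ⟩
    A ▷ (B ▷ c) + (A ▷ (b ◁ C) + a ◁ (B · C))  ≡⟨ +-assoc _ _ _ ⟨
    A ▷ (B ▷ c) + A ▷ (b ◁ C) + a ◁ (B · C)    ≡⟨ cong (_+ a ◁ (B · C)) (▷-+ A _ _) ⟨
    A ▷ (B ▷ c + b ◁ C) + a ◁ (B · C)          ∎)

  ⊗-identityˡ : ∀ x → (ẽ ⊗ x) ≡ x
  ⊗-identityˡ (A , a) = cong₂ _,_ (·-identityˡ A) (begin
    e ▷ a + 0m ◁ A  ≡⟨ cong₂ _+_ (▷-e a) (0m-◁ A) ⟩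
    a + 0m          ≡⟨ +-identityʳ a ⟩
    a               ∎)

  ⊗-identityʳ : ∀ x → (x ⊗ ẽ) ≡ x
  ⊗-identityʳ (A , a) = cong₂ _,_ (·-identityʳ A) (begin
    A ▷ 0m + a ◁ e  ≡⟨ cong₂ _+_ (▷-0m A) (◁-e a) ⟩
    0m + a          ≡⟨ +-identityˡ a ⟩
    a               ∎)

  ▷-inverseʳ : ∀ g a → g ▷ (inv g ▷ a) ≡ a
  ▷-inverseʳ g a = begin
    g ▷ (inv g ▷ a)  ≡⟨ ▷-· g (inv g) a ⟨
    (g · inv g) ▷ a  ≡⟨ cong (_▷ a) (·-inverseʳ g) ⟩
    e ▷ a            ≡⟨ ▷-e a ⟩
    a                ∎

  ◁-inverseˡ : ∀ a g → (a ◁ inv g) ◁ g ≡ a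
  ◁-inverseˡ a g = begin
    (a ◁ inv g) ◁ g  ≡⟨ ◁-· a (inv g) g ⟨
    a ◁ (inv g · g)  ≡⟨ cong (a ◁_) (·-inverseˡ g) ⟩
    a ◁ e            ≡⟨ ◁-e a ⟩
    a                ∎

  ⊗-inverseˡ : ∀ x → (inv~ x ⊗ x) ≡ ẽ
  ⊗-inverseˡ (A , a) = cong₂ _,_ (·-inverseˡ A) (begin
    inv A ▷ a + (- ((inv A ▷ a) ◁ inv A)) ◁ A  ≡⟨ cong (inv A ▷ a +_) (neg-◁ _ A) ⟩
    inv A ▷ a + - (((inv A ▷ a) ◁ inv A) ◁ A)  ≡⟨ cong (λ t → inv A ▷ a + - t) (◁-inverseˡ (inv A ▷ a) A) ⟩
    inv A ▷ a + - (inv A ▷ a)                  ≡⟨ +-inverseʳ (inv A ▷ a) ⟩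
    0m                                         ∎)

  ⊗-inverseʳ : ∀ x → (x ⊗ inv~ x) ≡ ẽ
  ⊗-inverseʳ (A , a) = cong₂ _,_ (·-inverseʳ A) (begin
    A ▷ (- ((inv A ▷ a) ◁ inv A)) + a ◁ inv A  ≡⟨ cong (_+ a ◁ inv A) (▷-neg A _) ⟩
    - (A ▷ ((inv A ▷ a) ◁ inv A)) + a ◁ inv A  ≡⟨ cong (λ t → - t + a ◁ inv A) (▷◁ A _ _) ⟨
    - ((A ▷ (inv A ▷ a)) ◁ inv A) + a ◁ inv A  ≡⟨ cong (λ t → - (t ◁ inv A) + a ◁ inv A) (▷-inverseʳ A a) ⟩
    - (a ◁ inv A) + a ◁ inv A                  ≡⟨ +-inverseˡ (a ◁ inv A) ⟩
    0m                                         ∎)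

  ⊗-isGroup : IsGroup _≡_ _⊗_ ẽ inv~
  ⊗-isGroup = record
    { isMonoid = record
      { isSemigroup = record
        { isMagma = record { isEquivalence = isEquivalence ; ∙-cong = cong₂ _⊗_ }
        ; assoc = ⊗-assoc }
      ; identity = ⊗-identityˡ , ⊗-identityʳ }
    ; inverse = ⊗-inverseˡ , ⊗-inverseʳ
    ; ⁻¹-cong = cong inv~ }

  G̃-group : Group _ _
  G̃-group = record { isGroup = ⊗-isGroup }

  open GroupProperties G̃-group
    using (\\-leftDividesʳ; //-rightDividesˡ; //-rightDividesʳ; ⁻¹-involutive; ⁻¹-anti-homo-∙)

  ⊗-inv-cancelˡ : ∀ x y z → (inv~ (x ⊗ y) ⊗ (x ⊗ z)) ≡ (inv~ y ⊗ z)
  ⊗-inv-cancelˡ x y z = begin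
    inv~ (x ⊗ y) ⊗ (x ⊗ z)         ≡⟨ cong (_⊗ (x ⊗ z)) (⁻¹-anti-homo-∙ x y) ⟩
    (inv~ y ⊗ inv~ x) ⊗ (x ⊗ z)    ≡⟨ ⊗-assoc (inv~ y) (inv~ x) (x ⊗ z) ⟩
    inv~ y ⊗ (inv~ x ⊗ (x ⊗ z))    ≡⟨ cong (inv~ y ⊗_) (\\-leftDividesʳ x z) ⟩
    inv~ y ⊗ z                     ∎

  Γ̃-ẽ : Γ̃ ẽ
  Γ̃-ẽ = Γ-e , M-0

  Γ̃-⊗ : ∀ {x y} → Γ̃ x → Γ̃ y → Γ̃ (x ⊗ y)
  Γ̃-⊗ (Γg , Ma) (Γh , Mb) = Γ-· Γg Γh , M-+ (M-▷ (Γ⊆Δ Γg) Mb) (M-◁ (Γ⊆Δ Γh) Ma)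

  Γ̃-inv : ∀ {x} → Γ̃ x → Γ̃ (inv~ x)
  Γ̃-inv (Γg , Ma) = Γ-inv Γg , M-neg (M-◁ (Γ⊆Δ (Γ-inv Γg)) (M-▷ (Γ⊆Δ (Γ-inv Γg)) Ma))

  ∈Γ̃Γ̃-refl : ∀ α → α ∈Γ̃ α Γ̃
  ∈Γ̃Γ̃-refl α = ẽ , ẽ , Γ̃-ẽ , Γ̃-ẽ , sym (trans (⊗-identityʳ (ẽ ⊗ α)) (⊗-identityˡ α))

  ∈Γ̃Γ̃-⊗Γ̃ : ∀ {x ξ h} → x ∈Γ̃ ξ Γ̃ → Γ̃ h → (x ⊗ h) ∈Γ̃ ξ Γ̃
  ∈Γ̃Γ̃-⊗Γ̃ {x} {ξ} {h} (g , k , Γg , Γk , x≡gξk) Γh = g , k ⊗ h , Γg , Γ̃-⊗ Γk Γh , (begin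
    x ⊗ h              ≡⟨ cong (_⊗ h) x≡gξk ⟩
    ((g ⊗ ξ) ⊗ k) ⊗ h  ≡⟨ ⊗-assoc (g ⊗ ξ) k h ⟩
    (g ⊗ ξ) ⊗ (k ⊗ h)  ∎)

  _∈_Γ̃_Γ̃ : G̃ → G̃ → G̃ → Set
  γ ∈ α Γ̃ β Γ̃ = ∃ λ k → ∃ λ h → Γ̃ k × Γ̃ h × γ ≡ (α ⊗ ((k ⊗ β) ⊗ h))

  Γ̃α⊆αΓ̃ : G̃ → Set
  Γ̃α⊆αΓ̃ α = ∀ g → Γ̃ g → ∃ λ g' → Γ̃ g' × (g ⊗ α) ≡ (α ⊗ g')

  module _ {α : G̃} (Γ̃α⊆αΓ̃-α : Γ̃α⊆αΓ̃ α) where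

    Γ̃αΓ̃⊆αΓ̃ : ∀ {x} → x ∈Γ̃ α Γ̃ → ∃ λ k → Γ̃ k × x ≡ (α ⊗ k)
    Γ̃αΓ̃⊆αΓ̃ {x} (g , h , Γg , Γh , x≡gαh) with Γ̃α⊆αΓ̃-α g Γg
    ... | g' , Γg' , gα≡αg' = g' ⊗ h , Γ̃-⊗ Γg' Γh , (begin
      x                  ≡⟨ x≡gαh ⟩
      (g ⊗ α) ⊗ h        ≡⟨ cong (_⊗ h) gα≡αg' ⟩
      (α ⊗ g') ⊗ h       ≡⟨ ⊗-assoc α g' h ⟩
      α ⊗ (g' ⊗ h)       ∎)

    Γ̃αβΓ̃⊆αΓ̃βΓ̃ : ∀ {β γ} → γ ∈Γ̃ (α ⊗ β) Γ̃ → γ ∈ α Γ̃ β Γ̃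
    Γ̃αβΓ̃⊆αΓ̃βΓ̃ {β} {γ} (g , h , Γg , Γh , γ≡gαβh) with Γ̃α⊆αΓ̃-α g Γg
    ... | g' , Γg' , gα≡αg' = g' , h , Γg' , Γh , (begin
      γ                        ≡⟨ γ≡gαβh ⟩
      (g ⊗ (α ⊗ β)) ⊗ h        ≡⟨ cong (_⊗ h) (⊗-assoc g α β) ⟨
      ((g ⊗ α) ⊗ β) ⊗ h        ≡⟨ cong (λ t → (t ⊗ β) ⊗ h) gα≡αg' ⟩
      ((α ⊗ g') ⊗ β) ⊗ h       ≡⟨ cong (_⊗ h) (⊗-assoc α g' β) ⟩
      (α ⊗ (g' ⊗ β)) ⊗ h       ≡⟨ ⊗-assoc α (g' ⊗ β) h ⟩
      α ⊗ ((g' ⊗ β) ⊗ h)       ∎)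

    counted-unique : ∀ {β γ δ δ'} → Counted α β γ δ → Counted α β γ δ' → Γ̃ (δ' ⊗ inv~ δ)
    counted-unique {β} {γ} {δ} {δ'} (_ , γδ⁻¹∈Γ̃αΓ̃) (_ , γδ'⁻¹∈Γ̃αΓ̃)
      with Γ̃αΓ̃⊆αΓ̃ γδ⁻¹∈Γ̃αΓ̃ | Γ̃αΓ̃⊆αΓ̃ γδ'⁻¹∈Γ̃αΓ̃
    ... | k , Γk , γδ⁻¹≡αk | k' , Γk' , γδ'⁻¹≡αk' =
      subst Γ̃ (sym δ'δ⁻¹≡k'⁻¹k) (Γ̃-⊗ (Γ̃-inv Γk') Γk)
      where
      δ'δ⁻¹≡k'⁻¹k : (δ' ⊗ inv~ δ) ≡ (inv~ k' ⊗ k)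
      δ'δ⁻¹≡k'⁻¹k = begin
        δ' ⊗ inv~ δ                             ≡⟨ cong (_⊗ inv~ δ) (⁻¹-involutive δ') ⟨
        inv~ (inv~ δ') ⊗ inv~ δ                 ≡⟨ ⊗-inv-cancelˡ γ (inv~ δ') (inv~ δ) ⟨
        inv~ (γ ⊗ inv~ δ') ⊗ (γ ⊗ inv~ δ)       ≡⟨ cong₂ (λ u v → inv~ u ⊗ v) γδ'⁻¹≡αk' γδ⁻¹≡αk ⟩
        inv~ (α ⊗ k') ⊗ (α ⊗ k)                 ≡⟨ ⊗-inv-cancelˡ α k' k ⟩
        inv~ k' ⊗ k                             ∎

    coeff-one : ∀ {β γ} → γ ∈ α Γ̃ β Γ̃ → Coeff≡1 α β γ
    coeff-one {β} {γ} (k , h , Γk , Γh , γ≡αδ) =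
      (δ , (k , h , Γk , Γh , refl) , subst (_∈Γ̃ α Γ̃) (sym γδ⁻¹≡α) (∈Γ̃Γ̃-refl α)) ,
      λ _ _ → counted-unique
      where
      δ : G̃
      δ = (k ⊗ β) ⊗ h
      γδ⁻¹≡α : (γ ⊗ inv~ δ) ≡ α
      γδ⁻¹≡α = trans (cong (_⊗ inv~ δ) γ≡αδ) (//-rightDividesʳ δ α)

    coeff-zero : ∀ {β γ} → ¬ γ ∈ α Γ̃ β Γ̃ → Coeff≡0 α β γ
    coeff-zero {β} {γ} γ∉αΓ̃βΓ̃ δ ((g , h , Γg , Γh , δ≡gβh) , γδ⁻¹∈Γ̃αΓ̃) with Γ̃αΓ̃⊆αΓ̃ γδ⁻¹∈Γ̃αΓ̃
    ... | k , Γk , γδ⁻¹≡αk = γ∉αΓ̃βΓ̃ (k ⊗ g , h , Γ̃-⊗ Γk Γg , Γh , (begin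
      γ                              ≡⟨ //-rightDividesˡ δ γ ⟨
      (γ ⊗ inv~ δ) ⊗ δ               ≡⟨ cong₂ _⊗_ γδ⁻¹≡αk δ≡gβh ⟩
      (α ⊗ k) ⊗ ((g ⊗ β) ⊗ h)        ≡⟨ ⊗-assoc α k _ ⟩
      α ⊗ (k ⊗ ((g ⊗ β) ⊗ h))        ≡⟨ cong (α ⊗_) (⊗-assoc k (g ⊗ β) h) ⟨
      α ⊗ ((k ⊗ (g ⊗ β)) ⊗ h)        ≡⟨ cong (λ t → α ⊗ (t ⊗ h)) (⊗-assoc k g β) ⟨
      α ⊗ (((k ⊗ g) ⊗ β) ⊗ h)        ∎))

    product-of-single-coset : ∀ {β} → (∀ k → Γ̃ k → (α ⊗ (k ⊗ β)) ∈Γ̃ (α ⊗ β) Γ̃) →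
      HeckeProdEq α β (α ⊗ β)
    product-of-single-coset {β} αkβ∈Γ̃αβΓ̃ γ _ =
      coeff-one ∘ Γ̃αβΓ̃⊆αΓ̃βΓ̃ , λ γ∉Γ̃αβΓ̃ → coeff-zero (γ∉Γ̃αβΓ̃ ∘ αΓ̃βΓ̃⊆Γ̃αβΓ̃)
      where
      αΓ̃βΓ̃⊆Γ̃αβΓ̃ : γ ∈ α Γ̃ β Γ̃ → γ ∈Γ̃ (α ⊗ β) Γ̃
      αΓ̃βΓ̃⊆Γ̃αβΓ̃ (k , h , Γk , Γh , γ≡αkβh) =
        subst (_∈Γ̃ (α ⊗ β) Γ̃) (sym (trans γ≡αkβh (sym (⊗-assoc α (k ⊗ β) h))))
          (∈Γ̃Γ̃-⊗Γ̃ (αkβ∈Γ̃αβΓ̃ k Γk) Γh)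

  ⊗-0mˡ : ∀ C g m → ((C , 0m) ⊗ (g , m)) ≡ (C · g , C ▷ m)
  ⊗-0mˡ C g m = cong (C · g ,_) (trans (cong (C ▷ m +_) (0m-◁ g)) (+-identityʳ (C ▷ m)))

  ⊗-0mʳ : ∀ g m C → ((g , m) ⊗ (C , 0m)) ≡ (g · C , m ◁ C)
  ⊗-0mʳ g m C = cong (g · C ,_) (trans (cong (_+ m ◁ C) (▷-0m g)) (+-identityˡ (m ◁ C)))

  ⊗-factor : ∀ k m → (k , m) ≡ ((k , 0m) ⊗ (e , inv k ▷ m))
  ⊗-factor k m = sym (trans (⊗-0mˡ k e (inv k ▷ m)) (cong₂ _,_ (·-identityʳ k) (▷-inverseʳ k m)))

  translation-slides : ∀ {A} a {m} → Δ A → M m →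
    ∃ λ p → M p × ((e , m) ⊗ (A , a)) ≡ ((A , a) ⊗ (e , p))
  translation-slides {A} a {m} ΔA Mm with AM⊇MA A ΔA m Mm
  ... | p , Mp , mA≡Ap = p , Mp , cong₂ _,_ (trans (·-identityˡ A) (sym (·-identityʳ A))) (begin
    e ▷ a + m ◁ A  ≡⟨ cong₂ _+_ (▷-e a) mA≡Ap ⟩
    a + A ▷ p      ≡⟨ +-comm a (A ▷ p) ⟩
    A ▷ p + a      ≡⟨ cong (A ▷ p +_) (◁-e a) ⟨
    A ▷ p + a ◁ e  ∎)

  module _ {C₀ : G} (ΔC₀ : Δ C₀) (C₀-central : ∀ X → Δ X → C₀ · X ≡ X · C₀) where

    central-Γ̃α⊆αΓ̃ : Γ̃α⊆αΓ̃ (C₀ , 0m)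
    central-Γ̃α⊆αΓ̃ (g , m) (Γg , Mm) with AM⊇MA C₀ ΔC₀ m Mm
    ... | m' , Mm' , mC₀≡C₀m' = (g , m') , (Γg , Mm') , (begin
      (g , m) ⊗ (C₀ , 0m)   ≡⟨ ⊗-0mʳ g m C₀ ⟩
      (g · C₀ , m ◁ C₀)     ≡⟨ cong₂ _,_ (sym (C₀-central g (Γ⊆Δ Γg))) mC₀≡C₀m' ⟩
      (C₀ · g , C₀ ▷ m')    ≡⟨ ⊗-0mˡ C₀ g m' ⟨
      (C₀ , 0m) ⊗ (g , m')  ∎)

    central-commutes : ∀ {k} → Δ k → ((C₀ , 0m) ⊗ (k , 0m)) ≡ ((k , 0m) ⊗ (C₀ , 0m))
    central-commutes {k} Δk = begin
      (C₀ , 0m) ⊗ (k , 0m)  ≡⟨ ⊗-0mˡ C₀ k 0m ⟩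
      (C₀ · k , C₀ ▷ 0m)    ≡⟨ cong₂ _,_ (C₀-central k Δk) (trans (▷-0m C₀) (sym (0m-◁ C₀))) ⟩
      (k · C₀ , 0m ◁ C₀)    ≡⟨ ⊗-0mʳ k 0m C₀ ⟨
      (k , 0m) ⊗ (C₀ , 0m)  ∎

    central-αΓ̃β⊆Γ̃αβΓ̃ : ∀ {A} a → Δ A → ∀ k → Γ̃ k →
      ((C₀ , 0m) ⊗ (k ⊗ (A , a))) ∈Γ̃ ((C₀ , 0m) ⊗ (A , a)) Γ̃
    central-αΓ̃β⊆Γ̃αβΓ̃ {A} a ΔA (k , m) (Γk , Mm)
      with translation-slides a ΔA (M-▷ (Γ⊆Δ (Γ-inv Γk)) Mm)
    ... | p , Mp , slide = (k , 0m) , (e , p) , (Γk , M-0) , (Γ-e , Mp) , (begin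
      α ⊗ ((k , m) ⊗ β)                  ≡⟨ cong (λ t → α ⊗ (t ⊗ β)) (⊗-factor k m) ⟩
      α ⊗ ((κ ⊗ (e , inv k ▷ m)) ⊗ β)    ≡⟨ cong (α ⊗_) (⊗-assoc κ _ β) ⟩
      α ⊗ (κ ⊗ ((e , inv k ▷ m) ⊗ β))    ≡⟨ cong (λ t → α ⊗ (κ ⊗ t)) slide ⟩
      α ⊗ (κ ⊗ (β ⊗ (e , p)))            ≡⟨ ⊗-assoc α κ _ ⟨
      (α ⊗ κ) ⊗ (β ⊗ (e , p))            ≡⟨ cong (_⊗ (β ⊗ (e , p))) (central-commutes (Γ⊆Δ Γk)) ⟩
      (κ ⊗ α) ⊗ (β ⊗ (e , p))            ≡⟨ ⊗-assoc κ α _ ⟩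
      κ ⊗ (α ⊗ (β ⊗ (e , p)))            ≡⟨ cong (κ ⊗_) (⊗-assoc α β (e , p)) ⟨
      κ ⊗ ((α ⊗ β) ⊗ (e , p))            ≡⟨ ⊗-assoc κ (α ⊗ β) (e , p) ⟨
      (κ ⊗ (α ⊗ β)) ⊗ (e , p)            ∎)
      where
      α β κ : G̃
      α = C₀ , 0m
      β = A , a
      κ = k , 0m

open HeckeSetting
open Tilde

lemma2p8 : (S : HeckeSetting) →
    ∀ C₀ → Δ S C₀ → (∀ X → Δ S X → _·_ S C₀ X ≡ _·_ S X C₀) →
    ∀ A a → Δ S A → M S a →
    HeckeProdEq S (C₀ , 0m S) (A , a) (_·_ S C₀ A , _▷_ S C₀ a)
lemma2p8 S C₀ ΔC₀ C₀-central A a ΔA _ =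
  subst (HeckeProdEq S (C₀ , 0m S) (A , a)) (⊗-0mˡ C₀ A a)
    (product-of-single-coset (central-Γ̃α⊆αΓ̃ ΔC₀ C₀-central)
                             (central-αΓ̃β⊆Γ̃αβΓ̃ ΔC₀ C₀-central a ΔA))
  where open HeckeProduct S
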